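{- Let $G$ and $H$ be two nontrivial connected graphs. Then $hn_{cc}(G\boxtimes H)=2$.
   Context: All graphs are finite, simple and undirected. Cycle convexity on a graph $G$: for $S\subseteq V(G)$, the cycle interval $\langle S\rangle$ is $S$ together with every vertex $w\in V(G)$ that lies on a cycle of the induced subgraph $G[S\cup\{w\}]$ passing through $w$ (i.e. $w$ forms a cycle with vertices of $S$). $S$ is (cycle) convex if $\langle S\rangle=S$. The cycle convex hull $\langle S\rangle_C$ is the smallest convex set containing $S$. $S$ is a hull set of $G$ if $\langle S\rangle_C=V(G)$, and the cycle hull number $hn_{cc}(G)$ is the minimum cardinality of a hull set of $G$. The strong product $G\boxtimes H$ has vertex set $V(G)\times V(H)$, with $(g_1,h_1)\sim(g_2,h_2)$ iff ($g_1\sim g_2$ and $h_1=h_2$) or ($g_1=g_2$ and $h_1\sim h_2$) or ($g_1\sim g_2$ and $h_1\sim h_2$). A graph is nontrivial if it has at least two vertices. -}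

module Defs where

open import Data.Nat using (ℕ; _≤_; _*_)
open import Data.Fin using (Fin; remQuot)
open import Data.Fin.Subset using (Subset; _∈_; _⊆_; ∣_∣)
open import Data.List using (List; []; _∷_; _++_; length)
open import Data.List.Relation.Unary.All using (All)
open import Data.List.Relation.Unary.Linked using (Linked)
open import Data.List.Relation.Unary.Unique.Propositional using (Unique)
open import Data.Product using (Σ; _×_; _,_; proj₁; proj₂)
open import Data.Sum using (_⊎_)
open import Data.Empty using (⊥)
open import Relation.Nullary using (¬_)
open import Relation.Binary.PropositionalEquality using (_≡_)

Rel : ℕ → Set₁
Rel n = Fin n → Fin n → Set

record IsSimple {n : ℕ} (E : Rel n) : Set where
  field
    sym    : ∀ {u v} → E u v → E v u
    irrefl : ∀ {u} → ¬ E u u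

data Walk {n : ℕ} (E : Rel n) : Fin n → Fin n → Set where
  here : ∀ {u} → Walk E u u
  step : ∀ {u v w} → E u v → Walk E v w → Walk E u w

Connected : {n : ℕ} → Rel n → Set
Connected {n} E = ∀ (u v : Fin n) → Walk E u v

Nontrivial : ℕ → Set
Nontrivial n = 2 ≤ n

StrongAdj : ∀ {m n} → Rel m → Rel n → Fin m × Fin n → Fin m × Fin n → Set
StrongAdj E F (g₁ , h₁) (g₂ , h₂) =
  (E g₁ g₂ × h₁ ≡ h₂) ⊎ ((g₁ ≡ g₂ × F h₁ h₂) ⊎ (E g₁ g₂ × F h₁ h₂))

StrongProduct : ∀ {m n} → Rel m → Rel n → Rel (m * n)
StrongProduct {m} {n} E F x y = StrongAdj E F (remQuot {m} n x) (remQuot {m} n y)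

-- w lies on a cycle of the induced subgraph G[S ∪ {w}] passing through w:
-- a cycle w, v₁, …, vₖ (k ≥ 2) of pairwise distinct vertices, all in S ∪ {w},
-- with consecutive vertices adjacent and vₖ adjacent to w.
CycleThrough : ∀ {n} → Rel n → Subset n → Fin n → Set
CycleThrough {n} E S w =
  Σ (List (Fin n)) λ vs →
    (2 ≤ length vs) × Unique (w ∷ vs) ×
    All (λ v → v ∈ S ⊎ v ≡ w) vs × Linked E (w ∷ vs ++ (w ∷ []))

InInterval : ∀ {n} → Rel n → Subset n → Fin n → Set
InInterval E S w = w ∈ S ⊎ CycleThrough E S w

Convex : ∀ {n} → Rel n → Subset n → Set
Convex {n} E T = ∀ (w : Fin n) → InInterval E T w → w ∈ T

InHull : ∀ {n} → Rel n → Subset n → Fin n → Set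
InHull {n} E S v = ∀ (T : Subset n) → Convex E T → S ⊆ T → v ∈ T

HullSet : ∀ {n} → Rel n → Subset n → Set
HullSet {n} E S = ∀ (v : Fin n) → InHull E S v

HullNumberIs : ∀ {n} → Rel n → ℕ → Set
HullNumberIs {n} E k =
  (Σ (Subset n) λ S → (∣ S ∣ ≡ k) × HullSet E S) ×
  (∀ (S : Subset n) → HullSet E S → k ≤ ∣ S ∣)

{-# OPTIONS --safe #-}
module Submission where

-- Every cycle through a vertex outside S passes through two distinct vertices of S, so a set with
-- fewer than two elements is convex and cannot be a hull set of a graph with two vertices.
-- Conversely, for edges g g' of G and h h' of H the four vertices {g, g'} × {h, h'} of G ⊠ H are
-- pairwise adjacent, so by triangles a convex set containing two of them contains all four.
-- Starting from a pair (g₀, h₀), (g₁, h₁) with g₀ ~ g₁ and h₀ ~ h₁ and propagating along walks,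
-- first in G and then in H, every convex superset of this pair is the whole vertex set.

open import Defs
open import Data.Nat using (ℕ; _*_; _+_; _≤_; _<_; z≤n; s≤s)
open import Data.Nat.Properties
  using (≤-trans; m<n⇒0<n; ≤-reflexive; ≤-antisym; ≤-<-trans; <⇒≱; ≮⇒≥; n≤1+n; +-suc; +-monoʳ-≤)
open import Data.Fin using (Fin; zero; combine; remQuot; punchIn; fromℕ<)
open import Data.Fin.Properties
  using (remQuot-combine; combine-remQuot; combine-injectiveˡ; punchInᵢ≢i)
open import Data.Fin.Subset using (Subset; _∈_; ∣_∣; ⁅_⁆; _∪_; inside; outside)
open import Data.Fin.Subset.Properties
  using (x∈⁅x⁆; x∈p∪q⁺; ∣⁅x⁆∣≡1; x∈p∧x≢y⇒x∈p-y; x∈p⇒∣p-x∣<∣p∣)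
open import Data.Vec using ([]; _∷_)
open import Data.List using ([]; _∷_)
open import Data.List.Relation.Unary.All using ([]; _∷_)
open import Data.List.Relation.Unary.AllPairs using ([]; _∷_)
open import Data.List.Relation.Unary.Linked using ([-]; _∷_)
open import Data.Product using (∃; _×_; _,_; proj₁; proj₂; uncurry)
open import Data.Sum using (_⊎_; inj₁; inj₂)
open import Function using (id; _∘_)
open import Relation.Nullary using (¬_; contradiction)
open import Relation.Binary.PropositionalEquality using (_≡_; _≢_; refl; sym; cong₂; subst; subst₂)

∣p∪q∣≤∣p∣+∣q∣ : ∀ {k} (p q : Subset k) → ∣ p ∪ q ∣ ≤ ∣ p ∣ + ∣ q ∣
∣p∪q∣≤∣p∣+∣q∣ []            []            = z≤n
∣p∪q∣≤∣p∣+∣q∣ (outside ∷ p) (outside ∷ q) = ∣p∪q∣≤∣p∣+∣q∣ p q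
∣p∪q∣≤∣p∣+∣q∣ (inside  ∷ p) (outside ∷ q) = s≤s (∣p∪q∣≤∣p∣+∣q∣ p q)
∣p∪q∣≤∣p∣+∣q∣ (outside ∷ p) (inside  ∷ q) =
  ≤-trans (s≤s (∣p∪q∣≤∣p∣+∣q∣ p q)) (≤-reflexive (sym (+-suc ∣ p ∣ ∣ q ∣)))
∣p∪q∣≤∣p∣+∣q∣ (inside  ∷ p) (inside  ∷ q) =
  s≤s (≤-trans (∣p∪q∣≤∣p∣+∣q∣ p q) (+-monoʳ-≤ ∣ p ∣ (n≤1+n ∣ q ∣)))

x∈p∧y∈p∧x≢y⇒2≤∣p∣ : ∀ {k} {x y : Fin k} {p : Subset k} → x ∈ p → y ∈ p → x ≢ y → 2 ≤ ∣ p ∣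
x∈p∧y∈p∧x≢y⇒2≤∣p∣ x∈p y∈p x≢y =
  ≤-<-trans (m<n⇒0<n (x∈p⇒∣p-x∣<∣p∣ y∈p-x)) (x∈p⇒∣p-x∣<∣p∣ x∈p)
  where y∈p-x = x∈p∧x≢y⇒x∈p-y y∈p (x≢y ∘ sym)

∣⁅x⁆∪⁅y⁆∣≡2 : ∀ {k} {x y : Fin k} → x ≢ y → ∣ ⁅ x ⁆ ∪ ⁅ y ⁆ ∣ ≡ 2
∣⁅x⁆∪⁅y⁆∣≡2 {x = x} {y} x≢y = ≤-antisym
  (≤-trans (∣p∪q∣≤∣p∣+∣q∣ ⁅ x ⁆ ⁅ y ⁆) (≤-reflexive (cong₂ _+_ (∣⁅x⁆∣≡1 x) (∣⁅x⁆∣≡1 y))))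
  (x∈p∧y∈p∧x≢y⇒2≤∣p∣ (x∈p∪q⁺ (inj₁ (x∈⁅x⁆ x))) (x∈p∪q⁺ (inj₂ (x∈⁅x⁆ y))) x≢y)

module _ {k} {R : Rel k} where

  cycleThrough⇒2≤∣S∣ : ∀ {S w} → CycleThrough R S w → 2 ≤ ∣ S ∣
  cycleThrough⇒2≤∣S∣ ([]        , ()          , _)
  cycleThrough⇒2≤∣S∣ (_ ∷ []    , s≤s ()      , _)
  cycleThrough⇒2≤∣S∣ (_ ∷ _ ∷ _ , _ , ((w≢u ∷ w≢v ∷ _) ∷ (u≢v ∷ _) ∷ _) , u∈S∪w ∷ v∈S∪w ∷ _ , _) =
    x∈p∧y∈p∧x≢y⇒2≤∣p∣ (inS u∈S∪w w≢u) (inS v∈S∪w w≢v) u≢v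
    where
    inS : ∀ {S w u} → u ∈ S ⊎ u ≡ w → w ≢ u → u ∈ S
    inS (inj₁ u∈S) _   = u∈S
    inS (inj₂ u≡w) w≢u = contradiction (sym u≡w) w≢u

  walk⇒firstStep : ∀ {u v} → Walk R u v → u ≢ v → ∃ (R u)
  walk⇒firstStep here         u≢u = contradiction refl u≢u
  walk⇒firstStep (step Ruw _) _   = _ , Ruw

  ∣S∣<2⇒convex : ∀ {S} → ∣ S ∣ < 2 → Convex R S
  ∣S∣<2⇒convex ∣S∣<2 w (inj₁ w∈S) = w∈S
  ∣S∣<2⇒convex ∣S∣<2 w (inj₂ cycle) = contradiction (cycleThrough⇒2≤∣S∣ cycle) (<⇒≱ ∣S∣<2)

  hullSet⇒2≤∣S∣ : ∀ {x y S} → x ≢ y → HullSet R S → 2 ≤ ∣ S ∣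
  hullSet⇒2≤∣S∣ {x} {y} {S} x≢y hull = ≮⇒≥ λ ∣S∣<2 →
    let convex = ∣S∣<2⇒convex ∣S∣<2
    in <⇒≱ ∣S∣<2 (x∈p∧y∈p∧x≢y⇒2≤∣p∣ (hull x S convex id) (hull y S convex id) x≢y)

  module _ (simple : IsSimple R) where
    open IsSimple simple renaming (sym to symmetric)

    adjacent⇒distinct : ∀ {u v} → R u v → u ≢ v
    adjacent⇒distinct Ruv refl = irrefl Ruv

    convex-triangle : ∀ {T w x y} → Convex R T → x ∈ T → y ∈ T →
                      R x y → R w x → R w y → w ∈ T
    convex-triangle {w = w} {x} {y} convex x∈T y∈T Rxy Rwx Rwy = convex w (inj₂
      ( x ∷ y ∷ []
      , s≤s (s≤s z≤n)
      , (adjacent⇒distinct Rwx ∷ adjacent⇒distinct Rwy ∷ []) ∷ (adjacent⇒distinct Rxy ∷ []) ∷ [] ∷ []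
      , inj₁ x∈T ∷ inj₁ y∈T ∷ []
      , Rwx ∷ Rxy ∷ symmetric Rwy ∷ [-]
      ))

neighbour : ∀ {m} {E : Rel m} → Nontrivial m → Connected E → ∀ g → ∃ (E g)
neighbour (s≤s (s≤s _)) connected g =
  walk⇒firstStep (connected g (punchIn g zero)) (punchInᵢ≢i g zero ∘ sym)

module _ {m n} {E : Rel m} {F : Rel n} (simpleE : IsSimple E) (simpleF : IsSimple F) where
  open IsSimple simpleE renaming (sym to symE; irrefl to irreflE)
  open IsSimple simpleF renaming (sym to symF; irrefl to irreflF)

  strongAdj-sym : ∀ {p q} → StrongAdj E F p q → StrongAdj E F q p
  strongAdj-sym (inj₁ (Egg' , refl))        = inj₁ (symE Egg' , refl)
  strongAdj-sym (inj₂ (inj₁ (refl , Fhh'))) = inj₂ (inj₁ (refl , symF Fhh'))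
  strongAdj-sym (inj₂ (inj₂ (Egg' , Fhh'))) = inj₂ (inj₂ (symE Egg' , symF Fhh'))

  strongAdj-irrefl : ∀ {p} → ¬ StrongAdj E F p p
  strongAdj-irrefl (inj₁ (Egg , _))        = irreflE Egg
  strongAdj-irrefl (inj₂ (inj₁ (_ , Fhh))) = irreflF Fhh
  strongAdj-irrefl (inj₂ (inj₂ (Egg , _))) = irreflE Egg

  strongProduct-isSimple : IsSimple (StrongProduct E F)
  strongProduct-isSimple = record { sym = strongAdj-sym ; irrefl = strongAdj-irrefl }

  module _ {T : Subset (m * n)} (convex : Convex (StrongProduct E F) T) where

    In : Fin m → Fin n → Set
    In g h = combine g h ∈ T

    private
      _~_ : Fin m × Fin n → Fin m × Fin n → Set
      _~_ = StrongAdj E F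

      horizontal : ∀ {g g' h} → E g g' → (g , h) ~ (g' , h)
      horizontal Egg' = inj₁ (Egg' , refl)

      vertical : ∀ {g h h'} → F h h' → (g , h) ~ (g , h')
      vertical Fhh' = inj₂ (inj₁ (refl , Fhh'))

      diagonal : ∀ {g g' h h'} → E g g' → F h h' → (g , h) ~ (g' , h')
      diagonal Egg' Fhh' = inj₂ (inj₂ (Egg' , Fhh'))

      combine-adj : ∀ {g h g' h'} → (g , h) ~ (g' , h') →
                    StrongProduct E F (combine g h) (combine g' h')
      combine-adj {g} {h} {g'} {h'} =
        subst₂ _~_ (sym (remQuot-combine g h)) (sym (remQuot-combine g' h'))

      triangle : ∀ {g h g' h' g'' h''} → In g h → In g' h' →
                 (g , h) ~ (g' , h') → (g'' , h'') ~ (g , h) → (g'' , h'') ~ (g' , h') → In g'' h''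
      triangle gh g'h' a b c =
        convex-triangle strongProduct-isSimple convex gh g'h'
          (combine-adj a) (combine-adj b) (combine-adj c)

    stepAlongF : ∀ {g g' h h'} → E g g' → F h h' → In g h → In g' h → In g h' × In g' h'
    stepAlongF e f gh g'h =
      triangle gh g'h (horizontal e) (vertical (symF f)) (diagonal e (symF f)) ,
      triangle gh g'h (horizontal e) (diagonal (symE e) (symF f)) (vertical (symF f))

    stepAlongE : ∀ {g g' h h'} → F h h' → E g g' → In g h → In g h' → In g' h × In g' h'
    stepAlongE f e gh gh' =
      triangle gh gh' (vertical f) (horizontal (symE e)) (diagonal (symE e) f) ,
      triangle gh gh' (vertical f) (diagonal (symE e) (symF f)) (horizontal (symE e))

    walkAlongF : ∀ {g g' h h'} → E g g' → Walk F h h' → In g h → In g' h → In g h' × In g' h'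
    walkAlongF e here          gh g'h = gh , g'h
    walkAlongF e (step f walk) gh g'h = uncurry (walkAlongF e walk) (stepAlongF e f gh g'h)

    walkAlongE : ∀ {g g' h h'} → F h h' → Walk E g g' → In g h → In g h' → In g' h × In g' h'
    walkAlongE f here          gh gh' = gh , gh'
    walkAlongE f (step e walk) gh gh' = uncurry (walkAlongE f walk) (stepAlongE f e gh gh')

    convex∋pair⇒full : ∀ {g₀ g₁ h₀ h₁} → Nontrivial m → Connected E → Connected F →
                       E g₀ g₁ → F h₀ h₁ → In g₀ h₀ → In g₁ h₁ → ∀ v → v ∈ T
    convex∋pair⇒full {g₀} {g₁} {h₀} {h₁} nontrivial connectedE connectedF e f g₀h₀ g₁h₁ v =
      subst (_∈ T) (combine-remQuot {m} n v) (uncurry everywhere (remQuot {m} n v))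
      where
      g₀h₁ : In g₀ h₁
      g₀h₁ = triangle g₀h₀ g₁h₁ (diagonal e f) (vertical (symF f)) (horizontal e)

      rows : ∀ g → In g h₀ × In g h₁
      rows g = walkAlongE f (connectedE g₀ g) g₀h₀ g₀h₁

      everywhere : ∀ g h → In g h
      everywhere g h =
        let (g' , e') = neighbour nontrivial connectedE g
        in proj₁ (walkAlongF e' (connectedF h₀ h) (proj₁ (rows g)) (proj₁ (rows g')))

  pair-hullSet : ∀ {g₀ g₁ h₀ h₁} → Nontrivial m → Connected E → Connected F → E g₀ g₁ → F h₀ h₁ →
                 HullSet (StrongProduct E F) (⁅ combine g₀ h₀ ⁆ ∪ ⁅ combine g₁ h₁ ⁆)
  pair-hullSet nontrivial connectedE connectedF e f v T convex pair⊆T =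
    convex∋pair⇒full convex nontrivial connectedE connectedF e f
      (pair⊆T (x∈p∪q⁺ (inj₁ (x∈⁅x⁆ _)))) (pair⊆T (x∈p∪q⁺ (inj₂ (x∈⁅x⁆ _)))) v

  hullNumberIs2 : ∀ {g₀ g₁ h₀ h₁} → Nontrivial m → Connected E → Connected F →
                  E g₀ g₁ → F h₀ h₁ → HullNumberIs (StrongProduct E F) 2
  hullNumberIs2 {g₀} {g₁} {h₀} {h₁} nontrivial connectedE connectedF e f =
    (⁅ x ⁆ ∪ ⁅ y ⁆ , ∣⁅x⁆∪⁅y⁆∣≡2 x≢y , pair-hullSet nontrivial connectedE connectedF e f) ,
    λ S → hullSet⇒2≤∣S∣ x≢y
    where
    x y : Fin (m * n)
    x = combine g₀ h₀
    y = combine g₁ h₁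

    x≢y : x ≢ y
    x≢y = adjacent⇒distinct simpleE e ∘ combine-injectiveˡ g₀ h₀ g₁ h₁

mainTheorem1 : ∀ (m n : ℕ) (E : Rel m) (F : Rel n) →
    IsSimple E → IsSimple F →
    Nontrivial m → Nontrivial n →
    Connected E → Connected F →
    HullNumberIs (StrongProduct E F) 2
mainTheorem1 m n E F simpleE simpleF nontrivialM nontrivialN connectedE connectedF =
  hullNumberIs2 simpleE simpleF nontrivialM connectedE connectedF
    (proj₂ (neighbour nontrivialM connectedE (fromℕ< nontrivialM)))
    (proj₂ (neighbour nontrivialN connectedF (fromℕ< nontrivialN)))
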